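{- For integers $i,j,d$ with $i\ge j$ and $j-d\ge4$, $\mathrm{occ}(F_{i-d},F_i)=\mathrm{occ}(F_{j-d},F_j)$.
   Context: $\varphi(\mathtt{a})=\mathtt{ab}$, $\varphi(\mathtt{b})=\mathtt{a}$, $F_i=\varphi^{i-1}(\mathtt{b})$ (so $F_1=\mathtt{b}$, $F_2=\mathtt{a}$, $F_i=F_{i-1}F_{i-2}$). $\mathrm{occ}(u,w)$ is the number of (possibly overlapping) occurrences of $u$ in $w$. -}

module Defs where

open import Data.Nat using (ℕ; zero; suc; _+_)
open import Data.Integer using (ℤ; +_; -[1+_])
open import Data.List using (List; []; _∷_; _++_; concatMap; length)
open import Data.Bool using (Bool; true; false; _∧_)

data Letter : Set where
  a b : Letter

φ₁ : Letter → List Letter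
φ₁ a = a ∷ b ∷ []
φ₁ b = a ∷ []

φ : List Letter → List Letter
φ = concatMap φ₁

iterφ : ℕ → List Letter → List Letter
iterφ zero w = w
iterφ (suc n) w = φ (iterφ n w)

Fib : ℕ → List Letter
Fib zero = []            -- unused junk value (F_0 is not defined in the paper)
Fib (suc n) = iterφ n (b ∷ [])

-- F on integer indices (junk value [] for non-positive indices)
F : ℤ → List Letter
F (+ n) = Fib n
F -[1+ n ] = []

_≟L_ : Letter → Letter → Bool
a ≟L a = true
b ≟L b = true
a ≟L b = false
b ≟L a = false

isPrefix : List Letter → List Letter → Bool
isPrefix [] w = true
isPrefix (x ∷ u) [] = false
isPrefix (x ∷ u) (y ∷ w) = (x ≟L y) ∧ isPrefix u w

-- number of (possibly overlapping) occurrences of u in w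
-- (counted over all starting positions 0 .. |w|; for nonempty u this is the usual count)
occ : List Letter → List Letter → ℕ
occ u [] with isPrefix u []
... | true = 1
... | false = 0
occ u (y ∷ w) with isPrefix u (y ∷ w)
... | true = suc (occ u w)
... | false = occ u w

-- Since F_{k+1} = φ(F_k), it suffices to show occ(φ(u), φ(w)) = occ(u, w) for
-- u = F_k, w = F_n with k ≥ 4, and to iterate.  As φ(a) and φ(b) both begin with a,
-- every occurrence in φ(w) of a word beginning with a starts at the image of a letter
-- of w.  If u ends in a, then φ(u) ends in the complete block φ(a) = ab, and the
-- occurrences of φ(u) in φ(w) correspond exactly to those of u in w.  If u = x b, then
-- φ(u) ends in φ(b) = a, which is also the first letter of φ(a), so they correspond
-- to occurrences of x b or of x a.  When u ends in aab, x a ends in aaa, which no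
-- Fibonacci word contains (φ-images avoid bb, and φ-images of bb-free words avoid
-- aaa).  Finally, F_k ends in a or in aab for k ≥ 4 because F_{k+2} = F_{k+1} F_k.
module Submission where

open import Defs
open import Data.Bool using (Bool; true; false; _∧_; _∨_)
open import Data.Bool.Properties using (∧-zeroʳ)
open import Data.Integer using (ℤ; +_; _-_; _≥_; +≤+; 0ℤ) renaming (_+_ to _+ℤ_)
open import Data.Integer.Properties using (+-minus-telescope; i≤j⇒0≤j-i)
open import Data.Integer.Tactic.RingSolver using (solve-∀)
open import Data.List using (List; []; _∷_; _++_; concat; map; tails)
open import Data.List.Properties using (++-assoc; map-++; concat-++)
open import Data.List.Relation.Unary.All as All using (All; []; _∷_)
open import Data.Nat using (ℕ; zero; suc; _≤_; s≤s) renaming (_+_ to _+ℕ_)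
open import Data.Nat.Properties using (≤-trans; m≤n+m)
open import Relation.Binary.PropositionalEquality
  using (_≡_; refl; sym; trans; cong; cong₂; subst; module ≡-Reasoning)

bit : Bool → ℕ
bit true = 1
bit false = 0

occ-[] : ∀ u → occ u [] ≡ bit (isPrefix u [])
occ-[] u with isPrefix u []
... | true = refl
... | false = refl

occ-∷ : ∀ u y w → occ u (y ∷ w) ≡ bit (isPrefix u (y ∷ w)) +ℕ occ u w
occ-∷ u y w with isPrefix u (y ∷ w)
... | true = refl
... | false = refl

φ-++ : ∀ xs ys → φ (xs ++ ys) ≡ φ xs ++ φ ys
φ-++ xs ys = trans (cong concat (map-++ φ₁ xs ys)) (sym (concat-++ (map φ₁ xs) (map φ₁ ys)))

Fib-suc-suc : ∀ n → Fib (suc (suc (suc n))) ≡ Fib (suc (suc n)) ++ Fib (suc n)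
Fib-suc-suc zero = refl
Fib-suc-suc (suc n) = begin
  φ (Fib (suc (suc (suc n))))                  ≡⟨ cong φ (Fib-suc-suc n) ⟩
  φ (Fib (suc (suc n)) ++ Fib (suc n))         ≡⟨ φ-++ (Fib (suc (suc n))) (Fib (suc n)) ⟩
  φ (Fib (suc (suc n))) ++ φ (Fib (suc n))     ∎
  where open ≡-Reasoning

b∷-not-prefix-φ : ∀ u w → isPrefix (b ∷ u) (φ w) ≡ false
b∷-not-prefix-φ u [] = refl
b∷-not-prefix-φ u (a ∷ w) = refl
b∷-not-prefix-φ u (b ∷ w) = refl

φ-∷ʳ-not-prefix-b∷ : ∀ v c t → isPrefix (φ (v ++ c ∷ [])) (b ∷ t) ≡ false
φ-∷ʳ-not-prefix-b∷ [] a t = refl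
φ-∷ʳ-not-prefix-b∷ [] b t = refl
φ-∷ʳ-not-prefix-b∷ (a ∷ v) c t = refl
φ-∷ʳ-not-prefix-b∷ (b ∷ v) c t = refl

isPrefix-φ-∷ʳa : ∀ v s → isPrefix (φ (v ++ a ∷ [])) (φ s) ≡ isPrefix (v ++ a ∷ []) s
isPrefix-φ-∷ʳa [] [] = refl
isPrefix-φ-∷ʳa [] (a ∷ s) = refl
isPrefix-φ-∷ʳa [] (b ∷ s) = b∷-not-prefix-φ [] s
isPrefix-φ-∷ʳa (a ∷ v) [] = refl
isPrefix-φ-∷ʳa (b ∷ v) [] = refl
isPrefix-φ-∷ʳa (a ∷ v) (a ∷ s) = isPrefix-φ-∷ʳa v s
isPrefix-φ-∷ʳa (a ∷ v) (b ∷ s) = b∷-not-prefix-φ _ s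
isPrefix-φ-∷ʳa (b ∷ v) (a ∷ s) = φ-∷ʳ-not-prefix-b∷ v a (φ s)
isPrefix-φ-∷ʳa (b ∷ v) (b ∷ s) = isPrefix-φ-∷ʳa v s

isPrefix-φ-∷ʳb : ∀ v s →
  isPrefix (φ (v ++ b ∷ [])) (φ s) ≡ isPrefix (v ++ a ∷ []) s ∨ isPrefix (v ++ b ∷ []) s
isPrefix-φ-∷ʳb [] [] = refl
isPrefix-φ-∷ʳb [] (a ∷ s) = refl
isPrefix-φ-∷ʳb [] (b ∷ s) = refl
isPrefix-φ-∷ʳb (a ∷ v) [] = refl
isPrefix-φ-∷ʳb (b ∷ v) [] = refl
isPrefix-φ-∷ʳb (a ∷ v) (a ∷ s) = isPrefix-φ-∷ʳb v s
isPrefix-φ-∷ʳb (a ∷ v) (b ∷ s) = b∷-not-prefix-φ _ s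
isPrefix-φ-∷ʳb (b ∷ v) (a ∷ s) = φ-∷ʳ-not-prefix-b∷ v b (φ s)
isPrefix-φ-∷ʳb (b ∷ v) (b ∷ s) = isPrefix-φ-∷ʳb v s

occ-φ-transfer : ∀ p q w → (∀ t → isPrefix p (b ∷ t) ≡ false) →
  All (λ s → isPrefix p (φ s) ≡ isPrefix q s) (tails w) → occ p (φ w) ≡ occ q w
occ-φ-transfer p q [] _ (eq ∷ []) = trans (occ-[] p) (trans (cong bit eq) (sym (occ-[] q)))
occ-φ-transfer p q (a ∷ w) no-b-start (eq ∷ eqs) = begin
  occ p (a ∷ b ∷ φ w)                                       ≡⟨ occ-∷ p a (b ∷ φ w) ⟩
  bit (isPrefix p (φ (a ∷ w))) +ℕ occ p (b ∷ φ w)           ≡⟨ cong₂ _+ℕ_ (cong bit eq) (occ-∷ p b (φ w)) ⟩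
  bit (isPrefix q (a ∷ w)) +ℕ (bit (isPrefix p (b ∷ φ w)) +ℕ occ p (φ w))
    ≡⟨ cong₂ (λ x y → bit (isPrefix q (a ∷ w)) +ℕ (bit x +ℕ y))
             (no-b-start (φ w)) (occ-φ-transfer p q w no-b-start eqs) ⟩
  bit (isPrefix q (a ∷ w)) +ℕ occ q w                       ≡⟨ occ-∷ q a w ⟨
  occ q (a ∷ w)                                             ∎
  where open ≡-Reasoning
occ-φ-transfer p q (b ∷ w) no-b-start (eq ∷ eqs) = begin
  occ p (a ∷ φ w)                                           ≡⟨ occ-∷ p a (φ w) ⟩
  bit (isPrefix p (φ (b ∷ w))) +ℕ occ p (φ w)
    ≡⟨ cong₂ _+ℕ_ (cong bit eq) (occ-φ-transfer p q w no-b-start eqs) ⟩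
  bit (isPrefix q (b ∷ w)) +ℕ occ q w                       ≡⟨ occ-∷ q b w ⟨
  occ q (b ∷ w)                                             ∎
  where open ≡-Reasoning

Avoids : List Letter → List Letter → Set
Avoids w u = All (λ s → isPrefix u s ≡ false) (tails w)

avoids-∷ : ∀ y u w → Avoids w u → Avoids w (y ∷ u)
avoids-∷ y u [] _ = refl ∷ []
avoids-∷ y u (z ∷ w) (_ ∷ avoid) =
  trans (cong ((y ≟L z) ∧_) (All.head avoid)) (∧-zeroʳ _) ∷ avoids-∷ y u w avoid

avoids-++ˡ : ∀ x u w → Avoids w u → Avoids w (x ++ u)
avoids-++ˡ [] u w avoid = avoid
avoids-++ˡ (y ∷ x) u w avoid = avoids-∷ y (x ++ u) w (avoids-++ˡ x u w avoid)

φ-avoids-bb : ∀ w → Avoids (φ w) (b ∷ b ∷ [])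
φ-avoids-bb [] = refl ∷ []
φ-avoids-bb (a ∷ w) = refl ∷ b∷-not-prefix-φ _ w ∷ φ-avoids-bb w
φ-avoids-bb (b ∷ w) = refl ∷ φ-avoids-bb w

φ-avoids-aaa : ∀ w → Avoids w (b ∷ b ∷ []) → Avoids (φ w) (a ∷ a ∷ a ∷ [])
φ-avoids-aaa [] _ = refl ∷ []
φ-avoids-aaa (a ∷ w) (_ ∷ avoid) = refl ∷ refl ∷ φ-avoids-aaa w avoid
φ-avoids-aaa (b ∷ []) _ = refl ∷ refl ∷ []
φ-avoids-aaa (b ∷ a ∷ w) (_ ∷ avoid) = refl ∷ φ-avoids-aaa (a ∷ w) avoid
φ-avoids-aaa (b ∷ b ∷ w) (() ∷ _)

Fib-avoids-aaa : ∀ n → Avoids (Fib n) (a ∷ a ∷ a ∷ [])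
Fib-avoids-aaa zero = refl ∷ []
Fib-avoids-aaa (suc zero) = refl ∷ refl ∷ []
Fib-avoids-aaa (suc (suc zero)) = refl ∷ refl ∷ []
Fib-avoids-aaa (suc (suc (suc n))) = φ-avoids-aaa (Fib (suc (suc n))) (φ-avoids-bb (Fib (suc n)))

data EndsInAOrAAB : List Letter → Set where
  ends-a : ∀ v → EndsInAOrAAB (v ++ a ∷ [])
  ends-aab : ∀ v → EndsInAOrAAB (v ++ a ∷ a ∷ b ∷ [])

EndsInAOrAAB-++ˡ : ∀ x u → EndsInAOrAAB u → EndsInAOrAAB (x ++ u)
EndsInAOrAAB-++ˡ x _ (ends-a v) = subst EndsInAOrAAB (++-assoc x v _) (ends-a (x ++ v))
EndsInAOrAAB-++ˡ x _ (ends-aab v) = subst EndsInAOrAAB (++-assoc x v _) (ends-aab (x ++ v))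

Fib-ends-in-a-or-aab : ∀ k → 4 ≤ k → EndsInAOrAAB (Fib k)
Fib-ends-in-a-or-aab (suc (suc (suc (suc n)))) (s≤s (s≤s (s≤s (s≤s _)))) = go n
  where
  go : ∀ n → EndsInAOrAAB (Fib (4 +ℕ n))
  go zero = ends-a (a ∷ b ∷ [])
  go (suc zero) = ends-aab (a ∷ b ∷ [])
  go (suc (suc n)) = subst EndsInAOrAAB (sym (Fib-suc-suc (3 +ℕ n)))
    (EndsInAOrAAB-++ˡ (Fib (5 +ℕ n)) _ (go n))

occ-φ-φ : ∀ u w → EndsInAOrAAB u → Avoids w (a ∷ a ∷ a ∷ []) → occ (φ u) (φ w) ≡ occ u w
occ-φ-φ _ w (ends-a v) _ =
  occ-φ-transfer _ _ w (φ-∷ʳ-not-prefix-b∷ v a) (All.universal (isPrefix-φ-∷ʳa v) (tails w))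
occ-φ-φ _ w (ends-aab v) avoid = begin
  occ (φ (v ++ a ∷ a ∷ b ∷ [])) (φ w)   ≡⟨ cong (λ u → occ (φ u) (φ w)) vaa∷ʳb ⟨
  occ (φ (vaa ++ b ∷ [])) (φ w)         ≡⟨ occ-φ-transfer _ _ w (φ-∷ʳ-not-prefix-b∷ vaa b) matches ⟩
  occ (vaa ++ b ∷ []) w                 ≡⟨ cong (λ u → occ u w) vaa∷ʳb ⟩
  occ (v ++ a ∷ a ∷ b ∷ []) w           ∎
  where
  open ≡-Reasoning
  vaa : List Letter
  vaa = v ++ a ∷ a ∷ []
  vaa∷ʳb : vaa ++ b ∷ [] ≡ v ++ a ∷ a ∷ b ∷ []
  vaa∷ʳb = ++-assoc v _ _
  vaaa-avoided : Avoids w (vaa ++ a ∷ [])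
  vaaa-avoided = subst (Avoids w) (sym (++-assoc v _ _)) (avoids-++ˡ v _ w avoid)
  matches : All (λ s → isPrefix (φ (vaa ++ b ∷ [])) (φ s) ≡ isPrefix (vaa ++ b ∷ []) s) (tails w)
  matches = All.map
    (λ {s} no-vaaa → trans (isPrefix-φ-∷ʳb vaa s) (cong (_∨ isPrefix (vaa ++ b ∷ []) s) no-vaaa))
    vaaa-avoided

occ-Fib-suc : ∀ k n → 4 ≤ k → 1 ≤ n → occ (Fib (suc k)) (Fib (suc n)) ≡ occ (Fib k) (Fib n)
occ-Fib-suc k n 4≤k@(s≤s _) (s≤s _) =
  occ-φ-φ (Fib k) (Fib n) (Fib-ends-in-a-or-aab k 4≤k) (Fib-avoids-aaa n)

occ-Fib-+ : ∀ e k n → 4 ≤ k → 1 ≤ n → occ (Fib (e +ℕ k)) (Fib (e +ℕ n)) ≡ occ (Fib k) (Fib n)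
occ-Fib-+ zero k n _ _ = refl
occ-Fib-+ (suc e) k n 4≤k 1≤n =
  trans (occ-Fib-suc (e +ℕ k) (e +ℕ n) (≤-trans 4≤k (m≤n+m k e)) (≤-trans 1≤n (m≤n+m n e)))
        (occ-Fib-+ e k n 4≤k 1≤n)

occ-F-+ : ∀ s k n → s ≥ 0ℤ → k ≥ + 4 → n ≥ + 1 → occ (F (s +ℤ k)) (F (s +ℤ n)) ≡ occ (F k) (F n)
occ-F-+ (+ e) (+ k) (+ n) _ (+≤+ 4≤k) (+≤+ 1≤n) = occ-Fib-+ e k n 4≤k 1≤n

i-j+j≡i : ∀ i j → (i - j) +ℤ j ≡ i
i-j+j≡i = solve-∀

lemma32 : (i j d : ℤ) → i ≥ j → j ≥ + 1 → j - d ≥ + 4 →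
    occ (F (i - d)) (F i) ≡ occ (F (j - d)) (F j)
lemma32 i j d i≥j j≥1 j-d≥4 = begin
  occ (F (i - d)) (F i)                           ≡⟨ cong₂ (λ k n → occ (F k) (F n))
                                                       (+-minus-telescope i j d) (i-j+j≡i i j) ⟨
  occ (F ((i - j) +ℤ (j - d))) (F ((i - j) +ℤ j)) ≡⟨ occ-F-+ (i - j) (j - d) j (i≤j⇒0≤j-i i≥j) j-d≥4 j≥1 ⟩
  occ (F (j - d)) (F j)                           ∎
  where open ≡-Reasoning
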